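{- For every adaptive service policy $\mathcal{S}$, \[ (1 - \epsilon) \cdot \mathcal{R}^{(r)}(\mathcal{S}) - \epsilon \cdot \mathcal{R}^{(r)}(\mathcal{S}^*) \;\leq\; \mathcal{R}^{(\tilde{r})}(\mathcal{S}) \;\leq\; \mathcal{R}^{(r)}(\mathcal{S}). \]
   Context: Problem: there are $n$ customers $1,\dots,n$; customer $i$ has reward $r_i\ge0$ and departure probability $p_i\in[0,1]$. Starting from $\mathcal{A}_1=[n]$, at each stage $t$ with nonempty available set $\mathcal{A}_t$, an adaptive service policy $\mathcal{S}$ serves a customer $\mathcal{S}(t,\mathcal{A}_t)\in\mathcal{A}_t$ (collecting its reward; the customer leaves), after which every other customer $i\in\mathcal{A}_t$ independently departs with probability $p_i$, and the remaining customers form $\mathcal{A}_{t+1}$. Let $\epsilon\in(0,\frac14)$ and $r_{\max}=\max_i r_i$. Rounded rewards: if $r_i\in[\frac{\epsilon}{n}r_{\max}, r_{\max}]$, $\tilde r_i$ is $r_i$ rounded down to the nearest (integer) power of $1+\epsilon$; if $r_i \le \frac{\epsilon}{n}r_{\max}$ (and not in the previous case), $\tilde r_i=0$. $\mathcal{R}^{(r)}(\mathcal{S})$ and $\mathcal{R}^{(\tilde r)}(\mathcal{S})$ denote the expected total reward of $\mathcal{S}$ (from state $(1,[n])$) when the rewards are $\{r_i\}$ and $\{\tilde r_i\}$, respectively, with the same departure probabilities. $\mathcal{S}^*$ is a policy maximizing $\mathcal{R}^{(r)}$.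
   Formalization: The rewards $r_i$, the departure probabilities $p_i$ and the parameter ε are taken in ℚ. -}

module Defs where

open import Data.Nat using (ℕ; zero; suc)
open import Data.Integer using (+_)
open import Data.Rational using (ℚ; 0ℚ; 1ℚ; _+_; _*_; _-_; _≤_; _<_; _⊔_; _/_)
open import Data.Fin using (Fin; zero; suc)
open import Data.Fin.Subset using (Subset; inside; outside; Nonempty; _∈_; _─_; ⁅_⁆; ⊤)
open import Data.Fin.Subset.Properties using (nonempty?)
open import Data.Vec using (Vec; []; _∷_; lookup)
open import Data.List using (List; [_]; map; _++_; foldr)
open import Data.Bool using (Bool; true; false; if_then_else_)
open import Data.Product using (Σ; ∃; _×_; _,_)
open import Data.Sum using (_⊎_)
open import Relation.Nullary using (yes; no; ¬_)
open import Relation.Binary.PropositionalEquality using (_≡_)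

pow : ℚ → ℕ → ℚ
pow a zero    = 1ℚ
pow a (suc k) = a * pow a k

-- x is an integer power of a:  x = a^k  or  x = a^(-k)  (i.e. x * a^k = 1), k ∈ ℕ
IsIntPow : ℚ → ℚ → Set
IsIntPow a x = ∃ λ (k : ℕ) → (x ≡ pow a k) ⊎ (x * pow a k ≡ 1ℚ)

RoundsDownTo : ℚ → ℚ → ℚ → Set
RoundsDownTo a r x = IsIntPow a x × x ≤ r × r < x * a

-- r_max = max_i r_i (for nonnegative rewards; 0 when n = 0)
rmax : ∀ {n} → (Fin n → ℚ) → ℚ
rmax {zero}  r = 0ℚ
rmax {suc n} r = r zero ⊔ rmax (λ i → r (suc i))

Rounded : ∀ {n} → ℚ → (Fin n → ℚ) → (Fin n → ℚ) → Set
Rounded {n} ε r rt = ∀ i →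
  ((ε * rmax r ≤ (+ n / 1) * r i) → 0ℚ < r i → RoundsDownTo (1ℚ + ε) (r i) (rt i))
  × (¬ (ε * rmax r ≤ (+ n / 1) * r i) → rt i ≡ 0ℚ)
  × (r i ≡ 0ℚ → rt i ≡ 0ℚ)

record Policy (n : ℕ) : Set where
  field
    choose : ℕ → (A : Subset n) → Nonempty A → Fin n
    valid  : ∀ t A (ne : Nonempty A) → choose t A ne ∈ A
open Policy public

allSubsets : ∀ n → List (Subset n)
allSubsets zero    = [ [] ]
allSubsets (suc n) = map (inside ∷_) (allSubsets n) ++ map (outside ∷_) (allSubsets n)

sumL : List ℚ → ℚ
sumL = foldr _+_ 0ℚ

prodFin : ∀ {n} → (Fin n → ℚ) → ℚ
prodFin {zero}  f = 1ℚ
prodFin {suc n} f = f zero * prodFin (λ i → f (suc i))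

-- probability that, starting from the set C of unserved remaining customers,
-- exactly the customers of B stay (each i ∈ C independently departs w.p. p_i)
stayProb : ∀ {n} → (Fin n → ℚ) → Subset n → Subset n → ℚ
stayProb p C B = prodFin λ i →
  if lookup C i
  then (if lookup B i then 1ℚ - p i else p i)
  else (if lookup B i then 0ℚ else 1ℚ)

-- expected reward collected from state (t, A), with fuel bounding the number of stages
value : ∀ {n} → ℕ → Policy n → (Fin n → ℚ) → (Fin n → ℚ) → ℕ → Subset n → ℚ
value zero    S r p t A = 0ℚ
value {n} (suc k) S r p t A with nonempty? A
... | no _   = 0ℚ
... | yes ne =
  let s = choose S t A ne
      C = A ─ ⁅ s ⁆
  in r s + sumL (map (λ B → stayProb p C B * value k S r p (suc t) B) (allSubsets n))

-- R^{(r)}(S): expected total reward from state (1, [n]); n stages always suffice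
-- since each stage serves one customer
ExpReward : ∀ {n} → Policy n → (Fin n → ℚ) → (Fin n → ℚ) → ℚ
ExpReward {n} S r p = value n S r p 1 ⊤

IsOptimal : ∀ {n} → (Fin n → ℚ) → (Fin n → ℚ) → Policy n → Set
IsOptimal {n} r p S* = ∀ (S : Policy n) → ExpReward S r p ≤ ExpReward S* r p

{-# OPTIONS --safe #-}
-- Expected reward is affinely monotone in the rewards: if a · f i ≤ b · g i + d for every
-- customer, then a · R⁽ᶠ⁾(S) ≤ b · R⁽ᵍ⁾(S) + n · d for every policy S, because a run serves at
-- most n customers and the next available set is drawn from a probability distribution.
-- Rounding down gives r̃ ≤ r. A customer is either rounded to within a factor 1 + ε, so that
-- (1 - ε) r i ≤ r̃ i, or dropped with n · r i ≤ ε · r_max; in both cases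
-- n (1 - ε) r i ≤ n r̃ i + ε r_max. Finally r_max ≤ R⁽ʳ⁾(S*), since the policy that serves the
-- most valuable customer first already earns r_max.
module Submission where

open import Defs
open import Data.Nat using (ℕ; zero; suc)
open import Data.Integer using (+_)
import Data.Integer as ℤ
import Data.Integer.Properties as ℤₚ
open import Data.Rational using (ℚ; 0ℚ; 1ℚ; _+_; _*_; _-_; _≤_; _<_; _/_; -_; Positive; nonNegative)
open import Data.Rational.Properties
open import Data.Nat.Coprimality using (1-coprimeTo)
import Data.Nat.Coprimality as Coprime
open import Data.Fin using (Fin; zero; suc)
open import Data.Fin.Subset using (Subset; inside; outside; Nonempty; _∈_; _─_; ⁅_⁆; ⊤)
open import Data.Fin.Subset.Properties using (nonempty?; _∈?_; ∈⊤)
open import Data.List using (List; []; _∷_; map; _++_)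
open import Data.List.Properties using (map-++; map-∘)
import Data.Vec as Vec
open import Data.Bool using (true; false; if_then_else_)
open import Data.Product using (∃; _×_; _,_; proj₁; proj₂)
open import Data.Sum using (_⊎_; inj₁; inj₂)
open import Function using (_∘_)
open import Level using (0ℓ)
open import Relation.Nullary using (yes; no; contradiction)
open import Relation.Nullary.Decidable.Core using (dec⇒maybe)
open import Relation.Binary using (tri<; tri≈; tri>)
open import Relation.Binary.PropositionalEquality
open import Tactic.RingSolver using (solve)
open import Tactic.RingSolver.Core.AlmostCommutativeRing using (AlmostCommutativeRing; fromCommutativeRing)

ℚ-ring : AlmostCommutativeRing 0ℓ 0ℓ
ℚ-ring = fromCommutativeRing +-*-commutativeRing (λ x → dec⇒maybe (0ℚ ≟ x))

open ≤-Reasoning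

0≤p+q : ∀ {p q} → 0ℚ ≤ p → 0ℚ ≤ q → 0ℚ ≤ p + q
0≤p+q = +-mono-≤

0≤p*q : ∀ {p q} → 0ℚ ≤ p → 0ℚ ≤ q → 0ℚ ≤ p * q
0≤p*q {p} {q} 0≤p 0≤q = subst (_≤ p * q) (*-zeroʳ p) (*-monoˡ-≤-nonNeg p {{nonNegative 0≤p}} 0≤q)

p≤p+q : ∀ {p q} → 0ℚ ≤ q → p ≤ p + q
p≤p+q {p} {q} 0≤q = subst (_≤ p + q) (+-identityʳ p) (+-monoʳ-≤ p 0≤q)

p≤q+r⇒p-r≤q : ∀ {p q r} → p ≤ q + r → p - r ≤ q
p≤q+r⇒p-r≤q {p} {q} {r} p≤q+r = begin
  p - r         ≤⟨ +-monoˡ-≤ (- r) p≤q+r ⟩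
  q + r - r     ≡⟨ solve (q ∷ r ∷ []) ℚ-ring ⟩
  q             ∎

p-q+q≡p : ∀ p q → p - q + q ≡ p
p-q+q≡p p q = solve (p ∷ q ∷ []) ℚ-ring

p-q≤p : ∀ {p q} → 0ℚ ≤ q → p - q ≤ p
p-q≤p {p} {q} 0≤q = p≤q+r⇒p-r≤q {p} {p} {q} (p≤p+q 0≤q)

affine-≤-+ : ∀ a b {x₁ x₂ y₁ y₂ c₁ c₂} →
  a * x₁ ≤ b * y₁ + c₁ → a * x₂ ≤ b * y₂ + c₂ →
  a * (x₁ + x₂) ≤ b * (y₁ + y₂) + (c₁ + c₂)
affine-≤-+ a b {x₁} {x₂} {y₁} {y₂} {c₁} {c₂} h₁ h₂ = begin
  a * (x₁ + x₂)                   ≡⟨ *-distribˡ-+ a x₁ x₂ ⟩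
  a * x₁ + a * x₂                 ≤⟨ +-mono-≤ h₁ h₂ ⟩
  (b * y₁ + c₁) + (b * y₂ + c₂)   ≡⟨ solve (b ∷ y₁ ∷ y₂ ∷ c₁ ∷ c₂ ∷ []) ℚ-ring ⟩
  b * (y₁ + y₂) + (c₁ + c₂)       ∎

affine-≤-* : ∀ a b c {w x y} → 0ℚ ≤ w →
  a * x ≤ b * y + c → a * (w * x) ≤ b * (w * y) + c * w
affine-≤-* a b c {w} {x} {y} 0≤w h = begin
  a * (w * x)             ≡⟨ solve (a ∷ w ∷ x ∷ []) ℚ-ring ⟩
  w * (a * x)             ≤⟨ *-monoˡ-≤-nonNeg w {{nonNegative 0≤w}} h ⟩
  w * (b * y + c)         ≡⟨ solve (b ∷ c ∷ w ∷ y ∷ []) ℚ-ring ⟩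
  b * (w * y) + c * w     ∎

fromℕ : ℕ → ℚ
fromℕ n = + n / 1

fromℕ-suc : ∀ n → fromℕ (suc n) ≡ 1ℚ + fromℕ n
fromℕ-suc n = begin-equality
  (+ 1 ℤ.+ + n) / 1              ≡⟨ cong (λ m → (+ 1 ℤ.+ m) / 1) (sym (ℤₚ.*-identityʳ (+ n))) ⟩
  (+ 1 ℤ.+ + n ℤ.* + 1) / 1      ≡⟨ cong (_+_ 1ℚ) (sym (normalize-coprime (Coprime.sym (1-coprimeTo n)))) ⟩
  1ℚ + fromℕ n                   ∎

0≤fromℕ : ∀ n → 0ℚ ≤ fromℕ n
0≤fromℕ n = nonNegative⁻¹ (fromℕ n) {{normalize-nonNeg n 1}}

fromℕ-suc-pos : ∀ n → Positive (fromℕ (suc n))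
fromℕ-suc-pos n = normalize-pos (suc n) 1

weightedSum : {X : Set} → (X → ℚ) → (X → ℚ) → List X → ℚ
weightedSum w x xs = sumL (map (λ B → w B * x B) xs)

weightedSum-nonNeg : ∀ {X : Set} {w x : X → ℚ} →
  (∀ B → 0ℚ ≤ w B) → (∀ B → 0ℚ ≤ x B) → ∀ xs → 0ℚ ≤ weightedSum w x xs
weightedSum-nonNeg 0≤w 0≤x []       = ≤-refl
weightedSum-nonNeg 0≤w 0≤x (B ∷ xs) =
  0≤p+q (0≤p*q (0≤w B) (0≤x B)) (weightedSum-nonNeg 0≤w 0≤x xs)

weightedSum-affine-≤ : ∀ {X : Set} {w x y : X → ℚ} a b c → (∀ B → 0ℚ ≤ w B) →
  (∀ B → a * x B ≤ b * y B + c) →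
  ∀ xs → a * weightedSum w x xs ≤ b * weightedSum w y xs + c * sumL (map w xs)
weightedSum-affine-≤ a b c 0≤w h [] =
  ≤-reflexive (solve (a ∷ b ∷ c ∷ []) ℚ-ring)
weightedSum-affine-≤ {w = w} {x} {y} a b c 0≤w h (B ∷ xs) = begin
  a * weightedSum w x (B ∷ xs)
    ≤⟨ affine-≤-+ a b (affine-≤-* a b c (0≤w B) (h B)) (weightedSum-affine-≤ a b c 0≤w h xs) ⟩
  b * weightedSum w y (B ∷ xs) + (c * w B + c * sumL (map w xs))
    ≡⟨ cong (_+_ (b * weightedSum w y (B ∷ xs))) (sym (*-distribˡ-+ c (w B) _)) ⟩
  b * weightedSum w y (B ∷ xs) + c * sumL (map w (B ∷ xs))
    ∎

sumL-++ : ∀ xs ys → sumL (xs ++ ys) ≡ sumL xs + sumL ys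
sumL-++ []       ys = sym (+-identityˡ (sumL ys))
sumL-++ (x ∷ xs) ys = trans (cong (_+_ x) (sumL-++ xs ys)) (sym (+-assoc x (sumL xs) (sumL ys)))

sumL-map-*ˡ : ∀ {X : Set} c (h : X → ℚ) xs → sumL (map (λ B → c * h B) xs) ≡ c * sumL (map h xs)
sumL-map-*ˡ c h []       = sym (*-zeroʳ c)
sumL-map-*ˡ c h (B ∷ xs) =
  trans (cong (_+_ (c * h B)) (sumL-map-*ˡ c h xs)) (sym (*-distribˡ-+ c (h B) _))

AreProbabilities : ∀ {n} → (Fin n → ℚ) → Set
AreProbabilities p = ∀ i → 0ℚ ≤ p i × p i ≤ 1ℚ

prodFin-nonNeg : ∀ {n} {f : Fin n → ℚ} → (∀ i → 0ℚ ≤ f i) → 0ℚ ≤ prodFin f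
prodFin-nonNeg {zero}  0≤f = nonNegative⁻¹ 1ℚ
prodFin-nonNeg {suc n} 0≤f = 0≤p*q (0≤f zero) (prodFin-nonNeg (0≤f ∘ suc))

stayProb-nonNeg : ∀ {n} {p : Fin n → ℚ} → AreProbabilities p → ∀ C B → 0ℚ ≤ stayProb p C B
stayProb-nonNeg prob C B =
  prodFin-nonNeg λ i → factor-nonNeg (prob i) (Vec.lookup C i) (Vec.lookup B i)
  where
  factor-nonNeg : ∀ {q} → 0ℚ ≤ q × q ≤ 1ℚ → ∀ c b →
    0ℚ ≤ (if c then (if b then 1ℚ - q else q) else (if b then 0ℚ else 1ℚ))
  factor-nonNeg {q} (_   , q≤1) true  true  = subst (_≤ 1ℚ - q) (+-inverseʳ q) (+-monoˡ-≤ (- q) q≤1)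
  factor-nonNeg     (0≤q , _  ) true  false = 0≤q
  factor-nonNeg     _           false true  = ≤-refl
  factor-nonNeg     _           false false = nonNegative⁻¹ 1ℚ

stayProb-total : ∀ {n} (p : Fin n → ℚ) C → sumL (map (stayProb p C) (allSubsets n)) ≡ 1ℚ
stayProb-total {zero}  p Vec.[]       = refl
stayProb-total {suc n} p (c Vec.∷ C) = begin-equality
    sumL (map g (map (inside Vec.∷_) L ++ map (outside Vec.∷_) L))
  ≡⟨ cong sumL (map-++ g (map (inside Vec.∷_) L) _) ⟩
    sumL (map g (map (inside Vec.∷_) L) ++ map g (map (outside Vec.∷_) L))
  ≡⟨ sumL-++ (map g (map (inside Vec.∷_) L)) _ ⟩
    sumL (map g (map (inside Vec.∷_) L)) + sumL (map g (map (outside Vec.∷_) L))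
  ≡⟨ cong₂ _+_ (cong sumL (sym (map-∘ L))) (cong sumL (sym (map-∘ L))) ⟩
    sumL (map (λ B → stays * h B) L) + sumL (map (λ B → departs * h B) L)
  ≡⟨ cong₂ _+_ (sumL-map-*ˡ stays h L) (sumL-map-*ˡ departs h L) ⟩
    stays * sumL (map h L) + departs * sumL (map h L)
  ≡⟨ cong (λ m → stays * m + departs * m) (stayProb-total (p ∘ suc) C) ⟩
    stays * 1ℚ + departs * 1ℚ
  ≡⟨ cong₂ _+_ (*-identityʳ stays) (*-identityʳ departs) ⟩
    stays + departs
  ≡⟨ complementary c ⟩
    1ℚ
  ∎
  where
  L = allSubsets n
  g = stayProb p (c Vec.∷ C)
  h = stayProb (p ∘ suc) C
  q = p zero
  stays = if c then 1ℚ - q else 0ℚ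
  departs = if c then q else 1ℚ
  complementary : ∀ c → (if c then 1ℚ - q else 0ℚ) + (if c then q else 1ℚ) ≡ 1ℚ
  complementary true  = p-q+q≡p 1ℚ q
  complementary false = refl

-- Definitionally the sum in the definition of value, so that value (suc k) S f p t A unfolds
-- to f s + expectedNext p (A ─ ⁅ s ⁆) (value k S f p (suc t)) for the served customer s.
expectedNext : ∀ {n} → (Fin n → ℚ) → Subset n → (Subset n → ℚ) → ℚ
expectedNext {n} p C x = weightedSum (stayProb p C) x (allSubsets n)

expectedNext-nonNeg : ∀ {n} {p : Fin n → ℚ} → AreProbabilities p → ∀ C {x : Subset n → ℚ} →
  (∀ B → 0ℚ ≤ x B) → 0ℚ ≤ expectedNext p C x
expectedNext-nonNeg {n} prob C 0≤x = weightedSum-nonNeg (stayProb-nonNeg prob C) 0≤x (allSubsets n)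

expectedNext-affine-≤ : ∀ {n} {p : Fin n → ℚ} → AreProbabilities p → ∀ C {x y : Subset n → ℚ} a b c →
  (∀ B → a * x B ≤ b * y B + c) → a * expectedNext p C x ≤ b * expectedNext p C y + c
expectedNext-affine-≤ {n} {p} prob C {x} {y} a b c h = begin
  a * expectedNext p C x
    ≤⟨ weightedSum-affine-≤ a b c (stayProb-nonNeg prob C) h (allSubsets n) ⟩
  b * expectedNext p C y + c * sumL (map (stayProb p C) (allSubsets n))
    ≡⟨ cong (λ m → b * expectedNext p C y + c * m) (stayProb-total p C) ⟩
  b * expectedNext p C y + c * 1ℚ
    ≡⟨ cong (_+_ (b * expectedNext p C y)) (*-identityʳ c) ⟩
  b * expectedNext p C y + c
    ∎

value-nonNeg : ∀ {n} (S : Policy n) {f p : Fin n → ℚ} → AreProbabilities p → (∀ i → 0ℚ ≤ f i) →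
  ∀ k t A → 0ℚ ≤ value k S f p t A
value-nonNeg S prob 0≤f zero    t A = ≤-refl
value-nonNeg S prob 0≤f (suc k) t A with nonempty? A
... | no _   = ≤-refl
... | yes ne = 0≤p+q (0≤f s) (expectedNext-nonNeg prob (A ─ ⁅ s ⁆) (value-nonNeg S prob 0≤f k (suc t)))
  where s = choose S t A ne

a*0≤b*0+c : ∀ a b {c} → 0ℚ ≤ c → a * 0ℚ ≤ b * 0ℚ + c
a*0≤b*0+c a b {c} 0≤c = begin
  a * 0ℚ         ≡⟨ *-zeroʳ a ⟩
  0ℚ             ≤⟨ 0≤c ⟩
  c              ≡⟨ solve (b ∷ c ∷ []) ℚ-ring ⟩
  b * 0ℚ + c     ∎

fromℕ-suc-* : ∀ k d → d + fromℕ k * d ≡ fromℕ (suc k) * d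
fromℕ-suc-* k d = begin-equality
  d + fromℕ k * d          ≡⟨ cong (_+ fromℕ k * d) (sym (*-identityˡ d)) ⟩
  1ℚ * d + fromℕ k * d     ≡⟨ sym (*-distribʳ-+ d 1ℚ (fromℕ k)) ⟩
  (1ℚ + fromℕ k) * d       ≡⟨ cong (_* d) (sym (fromℕ-suc k)) ⟩
  fromℕ (suc k) * d        ∎

value-affine-≤ : ∀ {n} (S : Policy n) {f g p : Fin n → ℚ} a b d → AreProbabilities p → 0ℚ ≤ d →
  (∀ i → a * f i ≤ b * g i + d) →
  ∀ k t A → a * value k S f p t A ≤ b * value k S g p t A + fromℕ k * d
value-affine-≤ S a b d prob 0≤d h zero    t A = a*0≤b*0+c a b (0≤p*q (0≤fromℕ 0) 0≤d)
value-affine-≤ {n} S {f} {g} {p} a b d prob 0≤d h (suc k) t A with nonempty? A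
... | no _   = a*0≤b*0+c a b (0≤p*q (0≤fromℕ (suc k)) 0≤d)
... | yes ne = begin
  a * (f s + expectedNext p C (value k S f p (suc t)))
    ≤⟨ affine-≤-+ a b (h s) (expectedNext-affine-≤ prob C a b _ (value-affine-≤ S a b d prob 0≤d h k (suc t))) ⟩
  b * (g s + expectedNext p C (value k S g p (suc t))) + (d + fromℕ k * d)
    ≡⟨ cong (_+_ (b * (g s + expectedNext p C (value k S g p (suc t))))) (fromℕ-suc-* k d) ⟩
  b * (g s + expectedNext p C (value k S g p (suc t))) + fromℕ (suc k) * d
    ∎
  where
  s = choose S t A ne
  C = A ─ ⁅ s ⁆

value-mono : ∀ {n} (S : Policy n) {f g p : Fin n → ℚ} → AreProbabilities p → (∀ i → f i ≤ g i) →
  ∀ k t A → value k S f p t A ≤ value k S g p t A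
value-mono S {f} {g} {p} prob f≤g k t A = begin
  value k S f p t A                       ≡⟨ sym (*-identityˡ _) ⟩
  1ℚ * value k S f p t A                  ≤⟨ value-affine-≤ S 1ℚ 1ℚ 0ℚ prob ≤-refl pointwise k t A ⟩
  1ℚ * value k S g p t A + fromℕ k * 0ℚ   ≡⟨ cong₂ _+_ (*-identityˡ (value k S g p t A)) (*-zeroʳ (fromℕ k)) ⟩
  value k S g p t A + 0ℚ                  ≡⟨ +-identityʳ _ ⟩
  value k S g p t A                       ∎
  where
  pointwise : ∀ i → 1ℚ * f i ≤ 1ℚ * g i + 0ℚ
  pointwise i = subst₂ _≤_ (sym (*-identityˡ (f i))) (sym (trans (+-identityʳ _) (*-identityˡ (g i)))) (f≤g i)

preferring : ∀ {n} → Fin n → (A : Subset n) → Nonempty A → Fin n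
preferring i A ne with i ∈? A
... | yes _ = i
... | no _  = proj₁ ne

preferring-∈ : ∀ {n} (i : Fin n) A ne → preferring i A ne ∈ A
preferring-∈ i A ne with i ∈? A
... | yes i∈A = i∈A
... | no _    = proj₂ ne

preferring-≡ : ∀ {n} (i : Fin n) A ne → i ∈ A → preferring i A ne ≡ i
preferring-≡ i A ne i∈A with i ∈? A
... | yes _   = refl
... | no i∉A  = contradiction i∈A i∉A

serveFirst : ∀ {n} → Fin n → Policy n
serveFirst i = record
  { choose = λ _ → preferring i
  ; valid  = λ _ → preferring-∈ i
  }

serveFirst-≥ : ∀ {n} {f p : Fin n → ℚ} → AreProbabilities p → (∀ i → 0ℚ ≤ f i) →
  ∀ k t {A} i → i ∈ A → f i ≤ value (suc k) (serveFirst i) f p t A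
serveFirst-≥ prob 0≤f k t {A} i i∈A with nonempty? A
... | no  empty = contradiction (i , i∈A) empty
... | yes ne rewrite preferring-≡ i A ne i∈A =
  p≤p+q (expectedNext-nonNeg prob (A ─ ⁅ i ⁆) (value-nonNeg (serveFirst i) prob 0≤f k (suc t)))

rmax-nonNeg : ∀ {n} {r : Fin n → ℚ} → (∀ i → 0ℚ ≤ r i) → 0ℚ ≤ rmax r
rmax-nonNeg {zero}  0≤r = ≤-refl
rmax-nonNeg {suc n} 0≤r = ≤-trans (0≤r zero) (p≤p⊔q _ _)

rmax-attained : ∀ {n} (r : Fin (suc n) → ℚ) → (∀ i → 0ℚ ≤ r i) → ∃ λ i → rmax r ≤ r i
rmax-attained {zero}  r 0≤r = zero , ⊔-lub ≤-refl (0≤r zero)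
rmax-attained {suc n} r 0≤r with rmax-attained (r ∘ suc) (0≤r ∘ suc)
... | j , rmax≤rⱼ with ≤-total (r zero) (r (suc j))
...   | inj₁ r₀≤rⱼ = suc j , ⊔-lub r₀≤rⱼ rmax≤rⱼ
...   | inj₂ rⱼ≤r₀ = zero , ⊔-lub ≤-refl (≤-trans rmax≤rⱼ rⱼ≤r₀)

rmax-≤-optimal : ∀ {n} {r p : Fin (suc n) → ℚ} {S* : Policy (suc n)} →
  AreProbabilities p → (∀ i → 0ℚ ≤ r i) → IsOptimal r p S* → rmax r ≤ ExpReward S* r p
rmax-≤-optimal {n} {r} {p} {S*} prob 0≤r optimal = begin
  rmax r                              ≤⟨ proj₂ (rmax-attained r 0≤r) ⟩
  r i                                 ≤⟨ serveFirst-≥ prob 0≤r n 1 i ∈⊤ ⟩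
  ExpReward (serveFirst i) r p        ≤⟨ optimal (serveFirst i) ⟩
  ExpReward S* r p                    ∎
  where i = proj₁ (rmax-attained r 0≤r)

[1-ε]*x≤x : ∀ {ε x} → 0ℚ ≤ ε → 0ℚ ≤ x → (1ℚ - ε) * x ≤ x
[1-ε]*x≤x {ε} {x} 0≤ε 0≤x = begin
  (1ℚ - ε) * x    ≡⟨ solve (ε ∷ x ∷ []) ℚ-ring ⟩
  x - ε * x       ≤⟨ p-q≤p (0≤p*q 0≤ε 0≤x) ⟩
  x               ∎

roundsDown-lower : ∀ {ε x y} → 0ℚ ≤ ε → 0ℚ ≤ x → x < y * (1ℚ + ε) → (1ℚ - ε) * x ≤ y
roundsDown-lower {ε} {x} {y} 0≤ε 0≤x x<y[1+ε] = *-cancelˡ-≤-pos (1ℚ + ε) {{1+ε-pos}} (begin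
  (1ℚ + ε) * ((1ℚ - ε) * x)   ≡⟨ solve (ε ∷ x ∷ []) ℚ-ring ⟩
  x - ε * ε * x               ≤⟨ p-q≤p (0≤p*q (0≤p*q 0≤ε 0≤ε) 0≤x) ⟩
  x                           ≤⟨ <⇒≤ x<y[1+ε] ⟩
  y * (1ℚ + ε)                ≡⟨ *-comm y (1ℚ + ε) ⟩
  (1ℚ + ε) * y                ∎)
  where
  1+ε-pos : Positive (1ℚ + ε)
  1+ε-pos = pos+nonNeg⇒pos 1ℚ ε {{nonNegative 0≤ε}}

rounded-dichotomy : ∀ {n ε} {r rt : Fin n → ℚ} → 0ℚ ≤ ε → (∀ i → 0ℚ ≤ r i) → Rounded ε r rt →
  ∀ i → RoundsDownTo (1ℚ + ε) (r i) (rt i) ⊎ (rt i ≡ 0ℚ × fromℕ n * r i ≤ ε * rmax r)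
rounded-dichotomy {n} {ε} {r} 0≤ε 0≤r rounded i
  with ε * rmax r ≤? fromℕ n * r i | <-cmp 0ℚ (r i)
... | yes large | tri< 0<rᵢ _ _ = inj₁ (proj₁ (rounded i) large 0<rᵢ)
... | _         | tri≈ _ 0≡rᵢ _ = inj₂ (proj₂ (proj₂ (rounded i)) (sym 0≡rᵢ) , (begin
  fromℕ n * r i    ≡⟨ cong (fromℕ n *_) (sym 0≡rᵢ) ⟩
  fromℕ n * 0ℚ     ≡⟨ *-zeroʳ (fromℕ n) ⟩
  0ℚ               ≤⟨ 0≤p*q 0≤ε (rmax-nonNeg 0≤r) ⟩
  ε * rmax r       ∎))
... | no small  | _             = inj₂ (proj₁ (proj₂ (rounded i)) small , <⇒≤ (≰⇒> small))
... | _         | tri> _ _ rᵢ<0 = contradiction (<-≤-trans rᵢ<0 (0≤r i)) (<-irrefl refl)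

rounded-≤ : ∀ {n ε} {r rt : Fin n → ℚ} → 0ℚ ≤ ε → (∀ i → 0ℚ ≤ r i) → Rounded ε r rt →
  ∀ i → rt i ≤ r i
rounded-≤ 0≤ε 0≤r rounded i with rounded-dichotomy 0≤ε 0≤r rounded i
... | inj₁ (_ , rtᵢ≤rᵢ , _) = rtᵢ≤rᵢ
... | inj₂ (rtᵢ≡0 , _)      = subst (_≤ _) (sym rtᵢ≡0) (0≤r i)

-- The paper's per-customer loss ε r_max / n, multiplied through by n to avoid division.
rounded-lower : ∀ {n ε} {r rt : Fin n → ℚ} → 0ℚ ≤ ε → (∀ i → 0ℚ ≤ r i) → Rounded ε r rt →
  ∀ i → fromℕ n * (1ℚ - ε) * r i ≤ fromℕ n * rt i + ε * rmax r
rounded-lower {n} {ε} {r} {rt} 0≤ε 0≤r rounded i with rounded-dichotomy 0≤ε 0≤r rounded i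
... | inj₁ (_ , _ , rᵢ<rtᵢ[1+ε]) = begin
  fromℕ n * (1ℚ - ε) * r i     ≡⟨ *-assoc (fromℕ n) (1ℚ - ε) (r i) ⟩
  fromℕ n * ((1ℚ - ε) * r i)   ≤⟨ *-monoˡ-≤-nonNeg (fromℕ n) {{nonNegative (0≤fromℕ n)}}
                                    (roundsDown-lower 0≤ε (0≤r i) rᵢ<rtᵢ[1+ε]) ⟩
  fromℕ n * rt i               ≤⟨ p≤p+q (0≤p*q 0≤ε (rmax-nonNeg 0≤r)) ⟩
  fromℕ n * rt i + ε * rmax r  ∎
... | inj₂ (rtᵢ≡0 , nrᵢ≤εR) = begin
  fromℕ n * (1ℚ - ε) * r i     ≡⟨ *-assoc (fromℕ n) (1ℚ - ε) (r i) ⟩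
  fromℕ n * ((1ℚ - ε) * r i)   ≤⟨ *-monoˡ-≤-nonNeg (fromℕ n) {{nonNegative (0≤fromℕ n)}}
                                    ([1-ε]*x≤x 0≤ε (0≤r i)) ⟩
  fromℕ n * r i                ≤⟨ nrᵢ≤εR ⟩
  ε * rmax r                   ≡⟨ sym (+-identityˡ _) ⟩
  0ℚ + ε * rmax r              ≡⟨ cong (_+ ε * rmax r) (sym (*-zeroʳ (fromℕ n))) ⟩
  fromℕ n * 0ℚ + ε * rmax r    ≡⟨ cong (λ z → fromℕ n * z + ε * rmax r) (sym rtᵢ≡0) ⟩
  fromℕ n * rt i + ε * rmax r  ∎

lemma3 : (n : ℕ) (ε : ℚ) (r rt p : Fin n → ℚ) →
    0ℚ < ε → ε < + 1 / 4 →
    (∀ i → 0ℚ ≤ r i) → (∀ i → 0ℚ ≤ p i × p i ≤ 1ℚ) →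
    Rounded ε r rt →
    (S* : Policy n) → IsOptimal r p S* →
    (S : Policy n) →
    ((1ℚ - ε) * ExpReward S r p - ε * ExpReward S* r p ≤ ExpReward S rt p)
    × (ExpReward S rt p ≤ ExpReward S r p)
lemma3 zero    ε r rt p _   _ _   _    _       S* _       S = ≤-reflexive (solve (ε ∷ []) ℚ-ring) , ≤-refl
lemma3 (suc m) ε r rt p 0<ε _ 0≤r prob rounded S* optimal S = lower , upper
  where
  n = suc m
  N = fromℕ n
  0≤ε = <⇒≤ 0<ε
  V = ExpReward S r p
  V̂ = ExpReward S rt p
  V* = ExpReward S* r p

  upper : V̂ ≤ V
  upper = value-mono S prob (rounded-≤ 0≤ε 0≤r rounded) n 1 ⊤

  lower : (1ℚ - ε) * V - ε * V* ≤ V̂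
  lower = p≤q+r⇒p-r≤q (*-cancelˡ-≤-pos N {{fromℕ-suc-pos m}} (begin
    N * ((1ℚ - ε) * V)         ≡⟨ sym (*-assoc N (1ℚ - ε) V) ⟩
    N * (1ℚ - ε) * V           ≤⟨ value-affine-≤ S (N * (1ℚ - ε)) N (ε * rmax r) prob
                                    (0≤p*q 0≤ε (rmax-nonNeg 0≤r)) (rounded-lower 0≤ε 0≤r rounded) n 1 ⊤ ⟩
    N * V̂ + N * (ε * rmax r)   ≤⟨ +-monoʳ-≤ (N * V̂) (*-monoˡ-≤-nonNeg N {{nonNegative (0≤fromℕ n)}}
                                    (*-monoˡ-≤-nonNeg ε {{nonNegative 0≤ε}} (rmax-≤-optimal {S* = S*} prob 0≤r optimal))) ⟩
    N * V̂ + N * (ε * V*)       ≡⟨ sym (*-distribˡ-+ N V̂ (ε * V*)) ⟩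
    N * (V̂ + ε * V*)           ∎))
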